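{- Let $n = 2^k p$, where $p$ is an odd prime and $k$ is a natural number, be a strongly $2$-near perfect number. Then there is an integer $a$ with $0 \le a \le k$ such that $$p = \frac{2^{k+1} - 2^a - 1}{1 + 2^{k-a}}.$$
   Context: $\sigma(n)$ denotes the sum of the positive divisors of $n$. A positive integer $n$ is called strongly $2$-near perfect if there is a positive divisor $d$ of $n$ with $d \ne n/d$ such that $\sigma(n) = 2n + d + \frac{n}{d}$. -}

module Defs where

open import Data.Nat using (ℕ; zero; suc; _+_; _*_)
open import Data.Nat.Divisibility using (_∣_; _∣?_)
open import Data.List using (List; filter; upTo; map)
open import Data.Nat.ListAction using (sum)
open import Data.Product using (∃₂; _×_)
open import Relation.Binary.PropositionalEquality using (_≡_; _≢_)

divisors : ℕ → List ℕ
divisors n = filter (_∣? n) (map suc (upTo n))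

σ : ℕ → ℕ
σ n = sum (divisors n)

-- n is strongly 2-near perfect: there is a positive divisor d of n with
-- d ≠ n/d and σ(n) = 2n + d + n/d.  We write e for n/d, i.e. d * e ≡ n.
Strongly2NearPerfect : ℕ → Set
Strongly2NearPerfect n =
  ∃₂ λ d e → d * e ≡ n × d ≢ e × σ n ≡ 2 * n + d + e

{-# OPTIONS --safe #-}
-- For an odd prime p the divisors of 2^k p are the 2^i and the 2^i p with
-- i ≤ k, so σ(2^k p) = (2^(k+1) − 1)(1 + p).  In the equation
-- σ(n) = 2n + d + n/d exactly one of d, n/d is a power of two 2^a, the other
-- being 2^(k−a) p; substituting and cancelling 2^(k+1) p leaves
-- p (1 + 2^(k−a)) + 2^a + 1 = 2^(k+1).
module Submission where

open import Defs
open import Data.Nat using (ℕ; zero; suc; _+_; _*_; _∸_; _^_; _≤_; z≤n; s≤s; NonZero; ≢-nonZero⁻¹)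
open import Data.Nat.Properties
open import Data.Nat.Divisibility
open import Data.Nat.Primality using (Prime; prime⇒irreducible; prime⇒nonZero; irreducible[2]; euclidsLemma; ¬prime[1])
open import Data.Nat.Coprimality using (Coprime; coprime-divisor)
open import Data.Nat.ListAction using (sum)
open import Data.Nat.ListAction.Properties using (sum-++; sum-↭)
open import Data.Nat.Solver using (module +-*-Solver)
open import Data.List using (List; []; _∷_; _++_; map; upTo; applyDownFrom)
open import Data.List.Membership.Propositional using (_∈_)
open import Data.List.Membership.Propositional.Properties
open import Data.List.Membership.Propositional.Properties.WithK using (unique∧set⇒bag)
open import Data.List.Relation.Unary.Unique.Propositional using (Unique)
import Data.List.Relation.Unary.Unique.Propositional.Properties as Unique
open import Data.List.Relation.Binary.BagAndSetEquality using (∼bag⇒↭)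
open import Data.Product using (∃; ∃₂; _×_; _,_; proj₂)
open import Data.Sum using (_⊎_; inj₁; inj₂)
open import Function using (_∘_)
open import Function.Bundles using (_⇔_; mk⇔; Equivalence)
open import Relation.Nullary using (¬_; yes; no; contradiction)
open import Relation.Binary.PropositionalEquality
  using (_≡_; _≢_; refl; sym; trans; cong; cong₂; subst; subst₂; module ≡-Reasoning)

open +-*-Solver
open ≡-Reasoning

sum-map-*ʳ : ∀ c xs → sum (map (_* c) xs) ≡ sum xs * c
sum-map-*ʳ c []       = refl
sum-map-*ʳ c (x ∷ xs) = trans (cong (x * c +_) (sum-map-*ʳ c xs)) (sym (*-distribʳ-+ c x (sum xs)))

∈-divisors⇔∣ : ∀ {n x} .{{_ : NonZero n}} → x ∈ divisors n ⇔ x ∣ n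
∈-divisors⇔∣ {n} = mk⇔ (proj₂ ∘ ∈-filter⁻ (_∣? n) {xs = map suc (upTo n)})
                        (λ x∣n → ∈-filter⁺ (_∣? n) (∈-range x∣n) x∣n)
  where
  ∈-range : ∀ {x} → x ∣ n → x ∈ map suc (upTo n)
  ∈-range {zero}  0∣n = contradiction (0∣⇒≡0 0∣n) (≢-nonZero⁻¹ n)
  ∈-range {suc y} x∣n = ∈-map⁺ suc (∈-upTo⁺ (∣⇒≤ x∣n))

divisors-unique : ∀ n → Unique (divisors n)
divisors-unique n = Unique.filter⁺ (_∣? n) (Unique.map⁺ suc-injective (Unique.upTo⁺ n))

σ≡sum : ∀ {n xs} .{{_ : NonZero n}} → Unique xs → (∀ {x} → x ∈ xs ⇔ x ∣ n) → σ n ≡ sum xs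
σ≡sum {n} xs-unique ∈xs⇔∣ =
  sum-↭ (∼bag⇒↭ (unique∧set⇒bag (divisors-unique n) xs-unique
    (mk⇔ (from ∈xs⇔∣ ∘ to ∈-divisors⇔∣) (from ∈-divisors⇔∣ ∘ to ∈xs⇔∣))))
  where open Equivalence

2^k≡2^i*2^[k∸i] : ∀ {i k} → i ≤ k → 2 ^ k ≡ 2 ^ i * 2 ^ (k ∸ i)
2^k≡2^i*2^[k∸i] {i} {k} i≤k = trans (cong (2 ^_) (sym (m+[n∸m]≡n i≤k))) (^-distribˡ-+-* 2 i (k ∸ i))

2^i∣2^k : ∀ {i k} → i ≤ k → 2 ^ i ∣ 2 ^ k
2^i∣2^k {i} {k} i≤k = divides (2 ^ (k ∸ i)) (trans (2^k≡2^i*2^[k∸i] i≤k) (*-comm (2 ^ i) _))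

powersOfTwo : ℕ → List ℕ
powersOfTwo k = applyDownFrom (2 ^_) (suc k)

∈-powersOfTwo⁺ : ∀ {i k} → i ≤ k → 2 ^ i ∈ powersOfTwo k
∈-powersOfTwo⁺ i≤k = ∈-applyDownFrom⁺ (2 ^_) (s≤s i≤k)

∈-powersOfTwo⁻ : ∀ {k x} → x ∈ powersOfTwo k → ∃ λ i → i ≤ k × x ≡ 2 ^ i
∈-powersOfTwo⁻ x∈ with i , s≤s i≤k , refl ← ∈-applyDownFrom⁻ (2 ^_) x∈ = i , i≤k , refl

powersOfTwo-unique : ∀ k → Unique (powersOfTwo k)
powersOfTwo-unique k =
  Unique.applyDownFrom⁺₁ (2 ^_) (suc k) (λ j<i _ → <⇒≢ (^-monoʳ-< 2 (s≤s (s≤s z≤n)) j<i) ∘ sym)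

sum-powersOfTwo : ∀ k → sum (powersOfTwo k) + 1 ≡ 2 ^ suc k
sum-powersOfTwo zero    = refl
sum-powersOfTwo (suc k) = begin
  2 ^ suc k + sum (powersOfTwo k) + 1   ≡⟨ +-assoc (2 ^ suc k) _ 1 ⟩
  2 ^ suc k + (sum (powersOfTwo k) + 1) ≡⟨ cong (2 ^ suc k +_) (sum-powersOfTwo k) ⟩
  2 ^ suc k + 2 ^ suc k                 ≡⟨ solve 1 (λ a → a :+ a := con 2 :* a) refl (2 ^ suc k) ⟩
  2 ^ suc (suc k)                       ∎

odd⇒coprime-2 : ∀ {x} → ¬ 2 ∣ x → Coprime x 2
odd⇒coprime-2 2∤x (d∣x , d∣2) with irreducible[2] d∣2
... | inj₁ d≡1 = d≡1
... | inj₂ refl = contradiction d∣x 2∤x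

∣2^k*m⇒ : ∀ k {m x} → x ∣ 2 ^ k * m → ∃₂ λ i y → i ≤ k × y ∣ m × x ≡ 2 ^ i * y
∣2^k*m⇒ zero    {m} {x} x∣m = 0 , x , z≤n , subst (x ∣_) (*-identityˡ m) x∣m , sym (*-identityˡ x)
∣2^k*m⇒ (suc k) {m} {x} x∣ with 2 ∣? x
... | yes (divides q refl) =
  let i , y , i≤k , y∣m , q≡ =
        ∣2^k*m⇒ k (*-cancelˡ-∣ {q} 2 (subst₂ _∣_ (*-comm q 2) (*-assoc 2 (2 ^ k) m) x∣))
  in suc i , y , s≤s i≤k , y∣m , (begin
    q * 2           ≡⟨ *-comm q 2 ⟩
    2 * q           ≡⟨ cong (2 *_) q≡ ⟩
    2 * (2 ^ i * y) ≡⟨ *-assoc 2 (2 ^ i) y ⟨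
    2 ^ suc i * y   ∎)
... | no 2∤x =
  let i , y , i≤k , y∣m , x≡ =
        ∣2^k*m⇒ k (coprime-divisor (odd⇒coprime-2 2∤x) (subst (x ∣_) (*-assoc 2 (2 ^ k) m) x∣))
  in i , y , m≤n⇒m≤1+n i≤k , y∣m , x≡

prime∣2^n⇒≡2 : ∀ {p} → Prime p → ∀ n → p ∣ 2 ^ n → p ≡ 2
prime∣2^n⇒≡2 p-prime zero    p∣1 = contradiction (subst Prime (∣1⇒≡1 p∣1) p-prime) ¬prime[1]
prime∣2^n⇒≡2 p-prime (suc n) p∣2^[1+n] with euclidsLemma 2 (2 ^ n) p-prime p∣2^[1+n]
... | inj₂ p∣2^n = prime∣2^n⇒≡2 p-prime n p∣2^n
... | inj₁ p∣2 with irreducible[2] p∣2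
...   | inj₁ refl = contradiction p-prime ¬prime[1]
...   | inj₂ p≡2  = p≡2

module _ {p} (p-prime : Prime p) (p≢2 : p ≢ 2) where

  instance
    p≢0 : NonZero p
    p≢0 = prime⇒nonZero p-prime

  2^i*p≢2^j : ∀ i j → 2 ^ i * p ≢ 2 ^ j
  2^i*p≢2^j i j eq = p≢2 (prime∣2^n⇒≡2 p-prime j (divides (2 ^ i) (sym eq)))

  ∣2^k*p⇒ : ∀ k {x} → x ∣ 2 ^ k * p → ∃ λ i → i ≤ k × (x ≡ 2 ^ i ⊎ x ≡ 2 ^ i * p)
  ∣2^k*p⇒ k x∣ with i , y , i≤k , y∣p , refl ← ∣2^k*m⇒ k x∣ with prime⇒irreducible p-prime y∣p
  ... | inj₁ refl = i , i≤k , inj₁ (*-identityʳ (2 ^ i))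
  ... | inj₂ refl = i , i≤k , inj₂ refl

  divisorsOf2^k*p : ℕ → List ℕ
  divisorsOf2^k*p k = powersOfTwo k ++ map (_* p) (powersOfTwo k)

  divisorsOf2^k*p-unique : ∀ k → Unique (divisorsOf2^k*p k)
  divisorsOf2^k*p-unique k =
    Unique.++⁺ (powersOfTwo-unique k) (Unique.map⁺ (*-cancelʳ-≡ _ _ p) (powersOfTwo-unique k)) disjoint
    where
    disjoint : ∀ {v} → ¬ (v ∈ powersOfTwo k × v ∈ map (_* p) (powersOfTwo k))
    disjoint (v∈ , v∈map) with j , _ , refl ← ∈-powersOfTwo⁻ v∈
                          with y , y∈ , v≡ ← ∈-map⁻ (_* p) v∈map
                          with i , _ , refl ← ∈-powersOfTwo⁻ y∈ = 2^i*p≢2^j i j (sym v≡)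

  ∈-divisorsOf2^k*p⇔∣ : ∀ k {x} → x ∈ divisorsOf2^k*p k ⇔ x ∣ 2 ^ k * p
  ∈-divisorsOf2^k*p⇔∣ k = mk⇔ to from
    where
    to : ∀ {x} → x ∈ divisorsOf2^k*p k → x ∣ 2 ^ k * p
    to x∈ with ∈-++⁻ (powersOfTwo k) x∈
    ... | inj₁ x∈pow with i , i≤k , refl ← ∈-powersOfTwo⁻ x∈pow =
      ∣-trans (2^i∣2^k i≤k) (m∣m*n {2 ^ k} p)
    ... | inj₂ x∈map with y , y∈ , refl ← ∈-map⁻ (_* p) {xs = powersOfTwo k} x∈map
                     with i , i≤k , refl ← ∈-powersOfTwo⁻ y∈ = *-monoˡ-∣ p (2^i∣2^k i≤k)
    from : ∀ {x} → x ∣ 2 ^ k * p → x ∈ divisorsOf2^k*p k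
    from x∣ with ∣2^k*p⇒ k x∣
    ... | i , i≤k , inj₁ refl = ∈-++⁺ˡ (∈-powersOfTwo⁺ i≤k)
    ... | i , i≤k , inj₂ refl = ∈-++⁺ʳ (powersOfTwo k) (∈-map⁺ (_* p) (∈-powersOfTwo⁺ i≤k))

  σ[2^k*p] : ∀ k → σ (2 ^ k * p) + (1 + p) ≡ 2 ^ suc k * (1 + p)
  σ[2^k*p] k = begin
    σ (2 ^ k * p) + (1 + p) ≡⟨ cong (_+ (1 + p)) σ≡S+S*p ⟩
    S + S * p + (1 + p)     ≡⟨ solve 2 (λ S p → S :+ S :* p :+ (con 1 :+ p) := (S :+ con 1) :* (con 1 :+ p)) refl S p ⟩
    (S + 1) * (1 + p)       ≡⟨ cong (_* (1 + p)) (sum-powersOfTwo k) ⟩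
    2 ^ suc k * (1 + p)     ∎
    where
    S : ℕ
    S = sum (powersOfTwo k)
    σ≡S+S*p : σ (2 ^ k * p) ≡ S + S * p
    σ≡S+S*p = begin
      σ (2 ^ k * p)                        ≡⟨ σ≡sum {{m*n≢0 (2 ^ k) p {{m^n≢0 2 k}}}}
                                                (divisorsOf2^k*p-unique k) (∈-divisorsOf2^k*p⇔∣ k) ⟩
      sum (divisorsOf2^k*p k)              ≡⟨ sum-++ (powersOfTwo k) _ ⟩
      S + sum (map (_* p) (powersOfTwo k)) ≡⟨ cong (S +_) (sum-map-*ʳ p (powersOfTwo k)) ⟩
      S + S * p                            ∎

  2^k*p≡2^i*[2^[k∸i]*p] : ∀ {i k} → i ≤ k → 2 ^ k * p ≡ 2 ^ i * (2 ^ (k ∸ i) * p)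
  2^k*p≡2^i*[2^[k∸i]*p] {i} {k} i≤k =
    trans (cong (_* p) (2^k≡2^i*2^[k∸i] i≤k)) (*-assoc (2 ^ i) (2 ^ (k ∸ i)) p)

  complementaryDivisors : ∀ k {d e} → d * e ≡ 2 ^ k * p →
                          ∃ λ i → i ≤ k × d + e ≡ 2 ^ i + 2 ^ (k ∸ i) * p
  complementaryDivisors k {d} {e} d*e≡ with ∣2^k*p⇒ k (divides e (trans (sym d*e≡) (*-comm d e)))
  ... | i , i≤k , inj₁ refl = i , i≤k , cong (2 ^ i +_) e≡
    where
    e≡ : e ≡ 2 ^ (k ∸ i) * p
    e≡ = *-cancelˡ-≡ e _ (2 ^ i) {{m^n≢0 2 i}} (trans d*e≡ (2^k*p≡2^i*[2^[k∸i]*p] i≤k))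
  ... | i , i≤k , inj₂ refl = k ∸ i , m∸n≤m k i , (begin
    2 ^ i * p + e                       ≡⟨ +-comm (2 ^ i * p) e ⟩
    e + 2 ^ i * p                       ≡⟨ cong₂ (λ a b → a + 2 ^ b * p) e≡ (sym (m∸[m∸n]≡n i≤k)) ⟩
    2 ^ (k ∸ i) + 2 ^ (k ∸ (k ∸ i)) * p ∎)
    where
    e≡ : e ≡ 2 ^ (k ∸ i)
    e≡ = *-cancelˡ-≡ e _ (2 ^ i * p) {{m*n≢0 (2 ^ i) p {{m^n≢0 2 i}}}} (begin
      2 ^ i * p * e               ≡⟨ d*e≡ ⟩
      2 ^ k * p                   ≡⟨ 2^k*p≡2^i*[2^[k∸i]*p] i≤k ⟩
      2 ^ i * (2 ^ (k ∸ i) * p)   ≡⟨ solve 3 (λ a b c → a :* (b :* c) := a :* c :* b) refl (2 ^ i) (2 ^ (k ∸ i)) p ⟩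
      2 ^ i * p * 2 ^ (k ∸ i)     ∎)

cancel-T*p : ∀ T p x y → T * p + (x + y * p) + (1 + p) ≡ T * (1 + p) → p * (1 + y) + x + 1 ≡ T
cancel-T*p T p x y eq = +-cancelˡ-≡ (T * p) _ _ (begin
  T * p + (p * (1 + y) + x + 1)  ≡⟨ solve 4 (λ T p x y → T :* p :+ (p :* (con 1 :+ y) :+ x :+ con 1)
                                                    := T :* p :+ (x :+ y :* p) :+ (con 1 :+ p)) refl T p x y ⟩
  T * p + (x + y * p) + (1 + p)  ≡⟨ eq ⟩
  T * (1 + p)                    ≡⟨ solve 2 (λ T p → T :* (con 1 :+ p) := T :* p :+ T) refl T p ⟩
  T * p + T                      ∎)

lemma14 : (k p : ℕ) → Prime p → p ≢ 2 → Strongly2NearPerfect (2 ^ k * p) →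
    ∃ λ a → a ≤ k × p * (1 + 2 ^ (k ∸ a)) + 2 ^ a + 1 ≡ 2 ^ (k + 1)
lemma14 k p p-prime p≢2 (d , e , d*e≡n , _ , σ≡n)
  with a , a≤k , d+e≡ ← complementaryDivisors p-prime p≢2 k {d} {e} d*e≡n =
  a , a≤k , trans (cancel-T*p (2 ^ suc k) p (2 ^ a) (2 ^ (k ∸ a)) σ-equation) (cong (2 ^_) (+-comm 1 k))
  where
  σ-equation : 2 ^ suc k * p + (2 ^ a + 2 ^ (k ∸ a) * p) + (1 + p) ≡ 2 ^ suc k * (1 + p)
  σ-equation = begin
    2 ^ suc k * p + (2 ^ a + 2 ^ (k ∸ a) * p) + (1 + p)
      ≡⟨ cong (_+ (1 + p)) (cong₂ _+_ (sym (*-assoc 2 (2 ^ k) p)) d+e≡) ⟨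
    2 * (2 ^ k * p) + (d + e) + (1 + p)                 ≡⟨ cong (_+ (1 + p)) (trans σ≡n (+-assoc _ d e)) ⟨
    σ (2 ^ k * p) + (1 + p)                             ≡⟨ σ[2^k*p] p-prime p≢2 k ⟩
    2 ^ suc k * (1 + p)                                 ∎
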